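{- Let $G$ be a graph with $n$ vertices and $m$ edges, and $S(G)$ its subdivision graph. Then $P_2\Theta_2(S(G))=(4M_1^2+2M_2^1+4)m-8m^2-2M_1^3+3M_1^2-6M_2^1-\alpha_{1,2}$, where the invariants on the right are evaluated at $G$.
   Context: $S(G)$ is obtained from $G$ by inserting a new vertex on each edge. $M_1^\alpha=\sum_v\deg(v)^\alpha$; $M_2^1=\sum_{uv\in E}\deg(u)\deg(v)$; $\alpha_{1,2}=\sum_{uv\in E}[\deg(u)\deg(v)^2+\deg(u)^2\deg(v)]$. For a graph $H$, $\Theta_2(H)=\sum\deg_H(u)\deg_H(w)$ over subgraphs of $H$ isomorphic to the path $P_3$ (each counted once), written $uvw$ with middle vertex $v$. For an invariant $f$, $P_2f(H)=\sum_{uv\in E(H)}f(H-\{u,v\})$, where $H-\{u,v\}$ deletes vertices $u,v$ and all incident edges. -}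

module Defs where

open import Data.Bool using (Bool; true; false; _∧_; _∨_; not)
open import Data.Nat using (ℕ; _+_; _*_; _^_)
open import Data.List using (List; []; _∷_; map; _++_; length; filterᵇ; foldr; concatMap)
open import Data.List.Relation.Unary.Unique.Propositional using (Unique)
open import Data.Product using (_×_; _,_)
open import Data.Sum using (_⊎_; inj₁; inj₂)
open import Relation.Binary.Definitions using (DecidableEquality)
open import Relation.Binary.PropositionalEquality using (_≡_)
open import Relation.Nullary.Decidable using (⌊_⌋)

Σℕ : List ℕ → ℕ
Σℕ = foldr _+_ 0

-- A (finite) graph: a finite list of vertices and an adjacency test.
-- Only the adjacency between listed vertices matters.
record Graph (V : Set) : Set where
  constructor mkGraph
  field
    verts : List V
    adj   : V → V → Bool
open Graph public

IsSimple : {V : Set} → Graph V → Set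
IsSimple G = Unique (verts G)
           × (∀ x y → adj G x y ≡ adj G y x)
           × (∀ x → adj G x x ≡ false)

pairs : {A : Set} → List A → List (A × A)
pairs []       = []
pairs (x ∷ xs) = map (λ y → (x , y)) xs ++ pairs xs

edges : {V : Set} → Graph V → List (V × V)
edges G = filterᵇ (λ { (u , w) → adj G u w }) (pairs (verts G))

numEdges : {V : Set} → Graph V → ℕ
numEdges G = length (edges G)

deg : {V : Set} → Graph V → V → ℕ
deg G v = length (filterᵇ (adj G v) (verts G))

M1 : {V : Set} → ℕ → Graph V → ℕ
M1 α G = Σℕ (map (λ v → deg G v ^ α) (verts G))

M2 : {V : Set} → Graph V → ℕ
M2 G = Σℕ (map (λ { (u , w) → deg G u * deg G w }) (edges G))

α12 : {V : Set} → Graph V → ℕ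
α12 G = Σℕ (map (λ { (u , w) → deg G u * deg G w ^ 2 + deg G u ^ 2 * deg G w }) (edges G))

-- Θ_2(H): sum over P3 subgraphs uvw (middle v, unordered end pair {u,w}, u ≠ w)
-- of deg(u) deg(w)
Θ2 : {V : Set} → Graph V → ℕ
Θ2 H = Σℕ (map (λ v →
         Σℕ (map (λ { (u , w) → deg H u * deg H w })
                 (filterᵇ (λ { (u , w) → adj H v u ∧ adj H v w }) (pairs (verts H)))))
       (verts H))

deleteTwo : {V : Set} → DecidableEquality V → Graph V → V → V → Graph V
deleteTwo _≟_ H u w =
  mkGraph (filterᵇ (λ x → not ⌊ x ≟ u ⌋ ∧ not ⌊ x ≟ w ⌋) (verts H)) (adj H)

P2 : {V : Set} → DecidableEquality V → (Graph V → ℕ) → Graph V → ℕ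
P2 _≟_ f H = Σℕ (map (λ { (u , w) → f (deleteTwo _≟_ H u w) }) (edges H))

-- subdivision graph: old vertices inj₁ x, one new vertex inj₂ (u , w) per edge uw,
-- adjacent exactly to u and w
subAdj : {V : Set} → DecidableEquality V → V ⊎ (V × V) → V ⊎ (V × V) → Bool
subAdj _≟_ (inj₁ x) (inj₂ (u , w)) = ⌊ x ≟ u ⌋ ∨ ⌊ x ≟ w ⌋
subAdj _≟_ (inj₂ (u , w)) (inj₁ x) = ⌊ x ≟ u ⌋ ∨ ⌊ x ≟ w ⌋
subAdj _≟_ _ _ = false

S : {V : Set} → DecidableEquality V → Graph V → Graph (V ⊎ (V × V))
S _≟_ G = mkGraph (map inj₁ (verts G) ++ map inj₂ (edges G)) (subAdj _≟_)

-- An edge of S(G) joins an end x of an edge e = xy of G to the subdivision vertex e, so P₂Θ₂(S(G)) sums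
-- Θ₂(K) over the 2m incidences (x, e), where K = S(G) − {x, e}.  Expanding the square of the neighbour-degree
-- sum N(v) = Σ_{u ~ v} deg u counts every path u v w twice, giving 2Θ₂(K) = Σ_v N(v)² − Σ_v deg(v)³.  Degrees
-- and neighbour-degree sums in K differ from those in S(G) only around x and y, and evaluating the two sums
-- yields 2Θ₂(K) = φ(x) − ψ(y), polynomials in deg_G and the neighbour-degree sum of G at a single vertex.
-- Summing over incidences turns Σ_x deg x · (φ x − ψ x) into M₁², M₁³, M₂ and α₁₂, since
-- Σ_x deg x · N_G(x) = 2M₂ and Σ_x deg x ² · N_G(x) = α₁₂.

module Submission where

open import Defs
open import Data.Bool using (Bool; true; false; _∧_; _∨_; not; T?)
open import Data.Bool.Properties using (T-≡; ∧-identityʳ)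
open import Data.Empty using (⊥-elim)
open import Data.Integer using (ℤ; +_; -_; _+_; _-_; _*_; 0ℤ; 1ℤ)
import Data.Integer.Properties as ℤ
open import Data.Integer.Tactic.RingSolver using (solve-∀)
open import Data.List using (List; []; _∷_; map; _++_; length; filterᵇ)
open import Data.List.Membership.Propositional using (_∈_)
open import Data.List.Membership.Propositional.Properties using (∈-map⁻; ∈-++⁻; ∈-filter⁻)
open import Data.List.Relation.Unary.All using (All; []; _∷_)
open import Data.List.Relation.Unary.All.Properties using (All¬⇒¬Any)
open import Data.List.Relation.Unary.AllPairs using ([]; _∷_)
open import Data.List.Relation.Unary.Any using (here; there)
open import Data.List.Relation.Unary.Unique.Propositional using (Unique)
import Data.List.Relation.Unary.Unique.Propositional.Properties as Unique
open import Data.Nat as ℕ using (ℕ)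
open import Data.Product using (_×_; _,_; proj₁; proj₂)
open import Data.Product.Properties using () renaming (≡-dec to ×-dec)
open import Data.Sum using (_⊎_; inj₁; inj₂)
open import Data.Sum.Properties using () renaming (≡-dec to ⊎-dec)
open import Function using (_∘_)
open import Function.Bundles using (Equivalence)
open import Relation.Binary.Definitions using (DecidableEquality)
open import Relation.Binary.PropositionalEquality
  using (_≡_; _≢_; refl; sym; trans; cong; cong₂; module ≡-Reasoning)
open import Relation.Nullary using (¬_)
open import Relation.Nullary.Decidable using (⌊_⌋; yes; no; ⌊⌋-map′)

ι : Bool → ℤ
ι true  = 1ℤ
ι false = 0ℤ

∑ : {A : Set} → List A → (A → ℤ) → ℤ
∑ []       f = 0ℤ
∑ (x ∷ xs) f = f x + ∑ xs f

module _ {A : Set} where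

  ∑-cong : (L : List A) {f g : A → ℤ} → (∀ x → f x ≡ g x) → ∑ L f ≡ ∑ L g
  ∑-cong []      f≗g = refl
  ∑-cong (x ∷ L) f≗g = cong₂ _+_ (f≗g x) (∑-cong L f≗g)

  ∑-cong-∈ : (L : List A) {f g : A → ℤ} → (∀ {x} → x ∈ L → f x ≡ g x) → ∑ L f ≡ ∑ L g
  ∑-cong-∈ []      f≗g = refl
  ∑-cong-∈ (x ∷ L) f≗g = cong₂ _+_ (f≗g (here refl)) (∑-cong-∈ L (f≗g ∘ there))

  ∑-zero : (L : List A) → ∑ L (λ _ → 0ℤ) ≡ 0ℤ
  ∑-zero []      = refl
  ∑-zero (x ∷ L) = trans (ℤ.+-identityˡ _) (∑-zero L)

  ∑-+ : (L : List A) (f g : A → ℤ) → ∑ L (λ x → f x + g x) ≡ ∑ L f + ∑ L g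
  ∑-+ []      f g = refl
  ∑-+ (x ∷ L) f g = trans (cong (_+_ (f x + g x)) (∑-+ L f g)) (interchange (f x) (g x) (∑ L f) (∑ L g))
    where
      interchange : ∀ a b c d → (a + b) + (c + d) ≡ (a + c) + (b + d)
      interchange = solve-∀

  ∑-*ˡ : (L : List A) (c : ℤ) (f : A → ℤ) → ∑ L (λ x → c * f x) ≡ c * ∑ L f
  ∑-*ˡ []      c f = sym (ℤ.*-zeroʳ c)
  ∑-*ˡ (x ∷ L) c f = trans (cong (_+_ (c * f x)) (∑-*ˡ L c f)) (sym (ℤ.*-distribˡ-+ c (f x) (∑ L f)))

  ∑-- : (L : List A) (f g : A → ℤ) → ∑ L (λ x → f x - g x) ≡ ∑ L f - ∑ L g
  ∑-- []      f g = refl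
  ∑-- (x ∷ L) f g = trans (cong (_+_ (f x - g x)) (∑-- L f g)) (interchange (f x) (g x) (∑ L f) (∑ L g))
    where
      interchange : ∀ a b c d → (a - b) + (c - d) ≡ (a + c) - (b + d)
      interchange = solve-∀

  ∑-+-* : (L : List A) (f : A → ℤ) (c : ℤ) (g : A → ℤ) → ∑ L (λ x → f x + c * g x) ≡ ∑ L f + c * ∑ L g
  ∑-+-* L f c g = trans (∑-+ L f (λ x → c * g x)) (cong (_+_ (∑ L f)) (∑-*ˡ L c g))

  ∑---* : (L : List A) (f : A → ℤ) (c : ℤ) (g : A → ℤ) → ∑ L (λ x → f x - c * g x) ≡ ∑ L f - c * ∑ L g
  ∑---* L f c g = trans (∑-- L f (λ x → c * g x)) (cong (_-_ (∑ L f)) (∑-*ˡ L c g))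

  ∑-++ : (L M : List A) (f : A → ℤ) → ∑ (L ++ M) f ≡ ∑ L f + ∑ M f
  ∑-++ []      M f = sym (ℤ.+-identityˡ _)
  ∑-++ (x ∷ L) M f = trans (cong (_+_ (f x)) (∑-++ L M f)) (sym (ℤ.+-assoc (f x) _ _))

  ∑-filterᵇ : (L : List A) (p : A → Bool) (f : A → ℤ) → ∑ (filterᵇ p L) f ≡ ∑ L (λ x → ι (p x) * f x)
  ∑-filterᵇ []      p f = refl
  ∑-filterᵇ (x ∷ L) p f with p x
  ... | true  = cong₂ _+_ (sym (ℤ.*-identityˡ (f x))) (∑-filterᵇ L p f)
  ... | false = trans (∑-filterᵇ L p f) (sym (ℤ.+-identityˡ _))

  ∑-Σℕ : (L : List A) (f : A → ℕ) → + Σℕ (map f L) ≡ ∑ L (λ x → + f x)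
  ∑-Σℕ []      f = refl
  ∑-Σℕ (x ∷ L) f = trans (ℤ.pos-+ (f x) _) (cong (_+_ (+ f x)) (∑-Σℕ L f))

  ∑-length : (L : List A) → + length L ≡ ∑ L (λ _ → 1ℤ)
  ∑-length []      = refl
  ∑-length (x ∷ L) = trans (ℤ.pos-+ 1 _) (cong (_+_ 1ℤ) (∑-length L))

module _ {A B : Set} where

  ∑-map : (L : List A) (g : A → B) (f : B → ℤ) → ∑ (map g L) f ≡ ∑ L (f ∘ g)
  ∑-map []      g f = refl
  ∑-map (x ∷ L) g f = cong (_+_ (f (g x))) (∑-map L g f)

  ∑-comm : (L : List A) (M : List B) (f : A → B → ℤ) →
           ∑ L (λ x → ∑ M (f x)) ≡ ∑ M (λ y → ∑ L (λ x → f x y))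
  ∑-comm []      M f = sym (∑-zero M)
  ∑-comm (x ∷ L) M f =
    trans (cong (_+_ (∑ M (f x))) (∑-comm L M f)) (sym (∑-+ M (f x) (λ y → ∑ L (λ x → f x y))))

module Kronecker {A : Set} (_≟_ : DecidableEquality A) where

  δ : A → A → ℤ
  δ x y = ι ⌊ x ≟ y ⌋

  δ-refl : ∀ x → δ x x ≡ 1ℤ
  δ-refl x with x ≟ x
  ... | yes _  = refl
  ... | no x≢x = ⊥-elim (x≢x refl)

  δ-≢ : ∀ {x y} → ¬ x ≡ y → δ x y ≡ 0ℤ
  δ-≢ {x} {y} x≢y with x ≟ y
  ... | yes x≡y = ⊥-elim (x≢y x≡y)
  ... | no _    = refl

  δ-sym : ∀ x y → δ x y ≡ δ y x
  δ-sym x y with y ≟ x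
  ... | yes refl = δ-refl x
  ... | no y≢x   = δ-≢ (y≢x ∘ sym)

  ∑-δ-∉ : (L : List A) {c : A} (F : A → ℤ) → All (c ≢_) L → ∑ L (λ z → δ z c * F z) ≡ 0ℤ
  ∑-δ-∉ []      F []           = refl
  ∑-δ-∉ (z ∷ L) F (c≢z ∷ c∉L) =
    cong₂ (λ d s → d * F z + s) (δ-≢ (c≢z ∘ sym)) (∑-δ-∉ L F c∉L)

  ∑-δ : (L : List A) {c : A} (F : A → ℤ) → Unique L → c ∈ L → ∑ L (λ z → δ z c * F z) ≡ F c
  ∑-δ (z ∷ L) F (c∉L ∷ _) (here refl) =
    trans (cong₂ (λ d s → d * F z + s) (δ-refl z) (∑-δ-∉ L F c∉L))
          (trans (ℤ.+-identityʳ _) (ℤ.*-identityˡ _))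
  ∑-δ (z ∷ L) {c} F (z∉L ∷ uL) (there c∈L) =
    trans (cong (λ d → d * F z + ∑ L (λ z → δ z c * F z)) (δ-≢ (λ { refl → All¬⇒¬Any z∉L c∈L })))
          (trans (ℤ.+-identityˡ _) (∑-δ L F uL c∈L))

  ∑-δ+δ : (L : List A) {x y : A} (F : A → ℤ) → Unique L → x ∈ L → y ∈ L →
          ∑ L (λ z → (δ z x + δ z y) * F z) ≡ F x + F y
  ∑-δ+δ L {x} {y} F uL x∈L y∈L =
    trans (∑-cong L (λ z → ℤ.*-distribʳ-+ (F z) (δ z x) (δ z y)))
          (trans (∑-+ L _ _) (cong₂ _+_ (∑-δ L F uL x∈L) (∑-δ L F uL y∈L)))

  ∑-without : (L : List A) {c : A} (F : A → ℤ) → Unique L → c ∈ L →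
              ∑ L (λ z → (1ℤ - δ z c) * F z) ≡ ∑ L F - F c
  ∑-without L {c} F uL c∈L = begin
    ∑ L (λ z → (1ℤ - δ z c) * F z)          ≡⟨ ∑-cong L (λ z → split (δ z c) (F z)) ⟩
    ∑ L (λ z → F z + - 1ℤ * (δ z c * F z))  ≡⟨ ∑-+ L F _ ⟩
    ∑ L F + ∑ L (λ z → - 1ℤ * (δ z c * F z)) ≡⟨ cong (_+_ (∑ L F)) (∑-*ˡ L (- 1ℤ) _) ⟩
    ∑ L F + - 1ℤ * ∑ L (λ z → δ z c * F z)  ≡⟨ cong (λ s → ∑ L F + - 1ℤ * s) (∑-δ L F uL c∈L) ⟩
    ∑ L F + - 1ℤ * F c                      ≡⟨ negate (∑ L F) (F c) ⟩
    ∑ L F - F c                              ∎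
    where
      open ≡-Reasoning
      split : ∀ d f → (1ℤ - d) * f ≡ f + - 1ℤ * (d * f)
      split = solve-∀
      negate : ∀ s f → s + - 1ℤ * f ≡ s - f
      negate = solve-∀

  ∑-agree-except₂ : (L : List A) {x y : A} (F G : A → ℤ) → Unique L → x ∈ L → y ∈ L → x ≢ y →
    (∀ z → z ≢ x → z ≢ y → F z ≡ G z) → ∑ L F ≡ ∑ L G + (F x - G x) + (F y - G y)
  ∑-agree-except₂ L {x} {y} F G uL x∈L y∈L x≢y F≡G = begin
    ∑ L F
      ≡⟨ ∑-cong L localise ⟩
    ∑ L (λ z → G z + δ z x * (F z - G z) + δ z y * (F z - G z))
      ≡⟨ trans (∑-+ L _ _) (cong (_+ ∑ L (λ z → δ z y * (F z - G z))) (∑-+ L _ _)) ⟩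
    ∑ L G + ∑ L (λ z → δ z x * (F z - G z)) + ∑ L (λ z → δ z y * (F z - G z))
      ≡⟨ cong₂ (λ p q → ∑ L G + p + q) (∑-δ L (λ z → F z - G z) uL x∈L) (∑-δ L (λ z → F z - G z) uL y∈L) ⟩
    ∑ L G + (F x - G x) + (F y - G y)  ∎
    where
      open ≡-Reasoning
      at-x : ∀ f g → f ≡ g + 1ℤ * (f - g) + 0ℤ * (f - g)
      at-x = solve-∀
      at-y : ∀ f g → f ≡ g + 0ℤ * (f - g) + 1ℤ * (f - g)
      at-y = solve-∀
      elsewhere : ∀ g → g ≡ g + 0ℤ * (g - g) + 0ℤ * (g - g)
      elsewhere = solve-∀
      localise : ∀ z → F z ≡ G z + δ z x * (F z - G z) + δ z y * (F z - G z)
      localise z with z ≟ x | z ≟ y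
      ... | yes refl | yes refl = ⊥-elim (x≢y refl)
      ... | yes refl | no _     = at-x (F z) (G z)
      ... | no _     | yes refl = at-y (F z) (G z)
      ... | no z≢x   | no z≢y   rewrite F≡G z z≢x z≢y = elsewhere (G z)

module _ {A : Set} where

  ∑-pairs+diagonal : (L : List A) (g : A → A → ℤ) →
    ∑ (pairs L) (λ (p , q) → g p q + g q p) + ∑ L (λ p → g p p) ≡ ∑ L (λ p → ∑ L (g p))
  ∑-pairs+diagonal []       g = refl
  ∑-pairs+diagonal (x ∷ xs) g = begin
    ∑ (map (x ,_) xs ++ pairs xs) F + (g x x + ∑ xs (λ p → g p p))
      ≡⟨ cong (_+ (g x x + ∑ xs (λ p → g p p))) (trans (∑-++ (map (x ,_) xs) (pairs xs) F)
           (cong (_+ ∑ (pairs xs) F) (trans (∑-map xs (x ,_) F) (∑-+ xs (g x) (λ y → g y x))))) ⟩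
    ((∑ xs (g x) + ∑ xs (λ y → g y x)) + ∑ (pairs xs) F) + (g x x + ∑ xs (λ p → g p p))
      ≡⟨ regroup (∑ xs (g x)) (∑ xs (λ y → g y x)) (∑ (pairs xs) F) (g x x) (∑ xs (λ p → g p p)) ⟩
    (g x x + ∑ xs (g x)) + (∑ xs (λ y → g y x) + (∑ (pairs xs) F + ∑ xs (λ p → g p p)))
      ≡⟨ cong (λ s → (g x x + ∑ xs (g x)) + (∑ xs (λ y → g y x) + s)) (∑-pairs+diagonal xs g) ⟩
    (g x x + ∑ xs (g x)) + (∑ xs (λ y → g y x) + ∑ xs (λ p → ∑ xs (g p)))
      ≡⟨ cong (_+_ (g x x + ∑ xs (g x))) (sym (∑-+ xs (λ y → g y x) (λ p → ∑ xs (g p)))) ⟩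
    (g x x + ∑ xs (g x)) + ∑ xs (λ p → g p x + ∑ xs (g p))  ∎
    where
      open ≡-Reasoning
      F : A × A → ℤ
      F (p , q) = g p q + g q p
      regroup : ∀ a b c d e → ((a + b) + c) + (d + e) ≡ (d + a) + (b + (c + e))
      regroup = solve-∀

  ∑-pairs-++ : (L M : List A) (f : A × A → ℤ) →
    ∑ (pairs (L ++ M)) f ≡ ∑ (pairs L) f + ∑ L (λ a → ∑ M (λ b → f (a , b))) + ∑ (pairs M) f
  ∑-pairs-++ []      M f = sym (ℤ.+-identityˡ _)
  ∑-pairs-++ (x ∷ L) M f = begin
    ∑ (map (x ,_) (L ++ M) ++ pairs (L ++ M)) f
      ≡⟨ ∑-++ (map (x ,_) (L ++ M)) (pairs (L ++ M)) f ⟩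
    ∑ (map (x ,_) (L ++ M)) f + ∑ (pairs (L ++ M)) f
      ≡⟨ cong₂ _+_ (trans (∑-map (L ++ M) (x ,_) f) (∑-++ L M (λ y → f (x , y)))) (∑-pairs-++ L M f) ⟩
    (xL + xM) + (∑ (pairs L) f + LM + ∑ (pairs M) f)
      ≡⟨ regroup xL xM (∑ (pairs L) f) LM (∑ (pairs M) f) ⟩
    (xL + ∑ (pairs L) f) + (xM + LM) + ∑ (pairs M) f
      ≡⟨ cong (λ s → s + (xM + LM) + ∑ (pairs M) f) (sym (trans (∑-++ (map (x ,_) L) (pairs L) f)
           (cong (_+ ∑ (pairs L) f) (∑-map L (x ,_) f)))) ⟩
    ∑ (pairs (x ∷ L)) f + ∑ (x ∷ L) (λ a → ∑ M (λ b → f (a , b))) + ∑ (pairs M) f  ∎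
    where
      open ≡-Reasoning
      xL = ∑ L (λ y → f (x , y))
      xM = ∑ M (λ y → f (x , y))
      LM = ∑ L (λ a → ∑ M (λ b → f (a , b)))
      regroup : ∀ a b c d e → (a + b) + (c + d + e) ≡ (a + c) + (b + d) + e
      regroup = solve-∀

  ∑-pairs-map : {B : Set} (h : B → A) (L : List B) (f : A × A → ℤ) →
    ∑ (pairs (map h L)) f ≡ ∑ (pairs L) (λ (p , q) → f (h p , h q))
  ∑-pairs-map h []      f = refl
  ∑-pairs-map h (x ∷ L) f =
    trans (∑-++ (map (h x ,_) (map h L)) (pairs (map h L)) f)
      (trans (cong₂ _+_ (trans (∑-map (map h L) _ f) (trans (∑-map L h _) (sym (∑-map L _ _))))
                        (∑-pairs-map h L f))
             (sym (∑-++ (map (x ,_) L) (pairs L) _)))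

  ∈-pairs⁻ : ∀ {p q} (L : List A) → (p , q) ∈ pairs L → p ∈ L × q ∈ L
  ∈-pairs⁻ (x ∷ L) pq∈ with ∈-++⁻ (map (x ,_) L) pq∈
  ... | inj₁ pq∈xL with ∈-map⁻ (x ,_) pq∈xL
  ...   | _ , q∈L , refl = here refl , there q∈L
  ∈-pairs⁻ (x ∷ L) pq∈ | inj₂ pq∈pairs with ∈-pairs⁻ L pq∈pairs
  ... | p∈L , q∈L = there p∈L , there q∈L

  pairs⁺-unique : (L : List A) → Unique L → Unique (pairs L)
  pairs⁺-unique []      _           = []
  pairs⁺-unique (x ∷ L) (x∉L ∷ uL) =
    Unique.++⁺ (Unique.map⁺ (cong proj₂) uL) (pairs⁺-unique L uL) disjoint
    where
      disjoint : ∀ {pq} → ¬ (pq ∈ map (x ,_) L × pq ∈ pairs L)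
      disjoint (∈xL , ∈pairs) with ∈-map⁻ (x ,_) ∈xL
      ... | _ , _ , refl = All¬⇒¬Any x∉L (proj₁ (∈-pairs⁻ L ∈pairs))

  ∑-square : (L : List A) (f : A → ℤ) →
    ∑ L f * ∑ L f ≡ + 2 * ∑ (pairs L) (λ (p , q) → f p * f q) + ∑ L (λ p → f p * f p)
  ∑-square L f = begin
    ∑ L f * ∑ L f
      ≡⟨ sym (∑-*ˡ L (∑ L f) f) ⟩
    ∑ L (λ p → ∑ L f * f p)
      ≡⟨ ∑-cong L (λ p → trans (ℤ.*-comm (∑ L f) (f p)) (sym (∑-*ˡ L (f p) f))) ⟩
    ∑ L (λ p → ∑ L (λ q → f p * f q))
      ≡⟨ sym (∑-pairs+diagonal L (λ p q → f p * f q)) ⟩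
    ∑ (pairs L) (λ (p , q) → f p * f q + f q * f p) + ∑ L (λ p → f p * f p)
      ≡⟨ cong (_+ ∑ L (λ p → f p * f p)) (trans (∑-cong (pairs L) (λ (p , q) → double (f p) (f q)))
                                                 (∑-*ˡ (pairs L) (+ 2) _)) ⟩
    + 2 * ∑ (pairs L) (λ (p , q) → f p * f q) + ∑ L (λ p → f p * f p)  ∎
    where
      open ≡-Reasoning
      double : ∀ a b → a * b + b * a ≡ + 2 * (a * b)
      double = solve-∀

ι-∧ : ∀ a b → ι (a ∧ b) ≡ ι a * ι b
ι-∧ true  b = sym (ℤ.*-identityˡ _)
ι-∧ false b = refl

ι-idem : ∀ a → ι a * ι a ≡ ι a
ι-idem true  = refl
ι-idem false = refl

ι-not : ∀ a → ι (not a) ≡ 1ℤ - ι a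
ι-not true  = refl
ι-not false = refl

pos-^2 : ∀ n → + (n ℕ.^ 2) ≡ + n * + n
pos-^2 n = trans (ℤ.pos-* n (n ℕ.* 1)) (cong (+ n *_) (trans (ℤ.pos-* n 1) (ℤ.*-identityʳ (+ n))))

pos-^3 : ∀ n → + (n ℕ.^ 3) ≡ + n * + n * + n
pos-^3 n = trans (ℤ.pos-* n (n ℕ.^ 2)) (trans (cong (+ n *_) (pos-^2 n)) (sym (ℤ.*-assoc (+ n) (+ n) (+ n))))

module _ {A : Set} (K : Graph A) where

  private
    D : A → ℤ
    D u = + deg K u

  deg-∑ : ∀ u → + deg K u ≡ ∑ (verts K) (λ v → ι (adj K u v))
  deg-∑ u = trans (∑-length (filterᵇ (adj K u) (verts K)))
                  (trans (∑-filterᵇ (verts K) (adj K u) (λ _ → 1ℤ)) (∑-cong (verts K) (λ v → ℤ.*-identityʳ _)))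

  nbrDegSum : A → ℤ
  nbrDegSum v = ∑ (verts K) (λ u → ι (adj K v u) * D u)

  Θ2-∑ : + Θ2 K ≡ ∑ (verts K) (λ v → ∑ (pairs (verts K)) (λ (p , q) → ι (adj K v p) * D p * (ι (adj K v q) * D q)))
  Θ2-∑ =
    trans (∑-Σℕ (verts K) _) (∑-cong (verts K) λ v →
      trans (∑-Σℕ (filterᵇ _ (pairs (verts K))) _)
        (trans (∑-filterᵇ (pairs (verts K)) _ _)
          (∑-cong (pairs (verts K)) λ (p , q) → begin
             ι (adj K v p ∧ adj K v q) * + (deg K p ℕ.* deg K q)
               ≡⟨ cong₂ _*_ (ι-∧ (adj K v p) (adj K v q)) (ℤ.pos-* (deg K p) (deg K q)) ⟩
             ι (adj K v p) * ι (adj K v q) * (D p * D q)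
               ≡⟨ shuffle (ι (adj K v p)) (ι (adj K v q)) (D p) (D q) ⟩
             ι (adj K v p) * D p * (ι (adj K v q) * D q)  ∎)))
    where
      open ≡-Reasoning
      shuffle : ∀ a b c d → a * b * (c * d) ≡ a * c * (b * d)
      shuffle = solve-∀

  Θ2-nbrDegSum : (∀ x y → adj K x y ≡ adj K y x) →
    + 2 * + Θ2 K + ∑ (verts K) (λ u → D u * D u * D u) ≡ ∑ (verts K) (λ v → nbrDegSum v * nbrDegSum v)
  Θ2-nbrDegSum adj-sym = begin
    + 2 * + Θ2 K + ∑ V (λ u → D u * D u * D u)
      ≡⟨ cong₂ _+_ (trans (cong (+ 2 *_) Θ2-∑) (sym (∑-*ˡ V (+ 2) _))) (sym cubes) ⟩
    ∑ V (λ v → + 2 * ∑ (pairs V) (λ (p , q) → h v p * h v q)) + ∑ V (λ v → ∑ V (λ u → h v u * h v u))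
      ≡⟨ sym (∑-+ V _ _) ⟩
    ∑ V (λ v → + 2 * ∑ (pairs V) (λ (p , q) → h v p * h v q) + ∑ V (λ u → h v u * h v u))
      ≡⟨ ∑-cong V (λ v → sym (∑-square V (h v))) ⟩
    ∑ V (λ v → nbrDegSum v * nbrDegSum v)  ∎
    where
      open ≡-Reasoning
      V = verts K
      h : A → A → ℤ
      h v u = ι (adj K v u) * D u
      h² : ∀ v u → h v u * h v u ≡ D u * D u * ι (adj K u v)
      h² v u = begin
        ι (adj K v u) * D u * (ι (adj K v u) * D u)  ≡⟨ shuffle (ι (adj K v u)) (D u) ⟩
        ι (adj K v u) * ι (adj K v u) * (D u * D u)  ≡⟨ cong (λ i → i * (D u * D u)) (ι-idem (adj K v u)) ⟩
        ι (adj K v u) * (D u * D u)                  ≡⟨ ℤ.*-comm _ (D u * D u) ⟩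
        D u * D u * ι (adj K v u)                    ≡⟨ cong (λ b → D u * D u * ι b) (adj-sym v u) ⟩
        D u * D u * ι (adj K u v)                    ∎
        where
          shuffle : ∀ i d → i * d * (i * d) ≡ i * i * (d * d)
          shuffle = solve-∀
      cubes : ∑ V (λ v → ∑ V (λ u → h v u * h v u)) ≡ ∑ V (λ u → D u * D u * D u)
      cubes = begin
        ∑ V (λ v → ∑ V (λ u → h v u * h v u))             ≡⟨ ∑-comm V V _ ⟩
        ∑ V (λ u → ∑ V (λ v → h v u * h v u))             ≡⟨ ∑-cong V (λ u → ∑-cong V (λ v → h² v u)) ⟩
        ∑ V (λ u → ∑ V (λ v → D u * D u * ι (adj K u v))) ≡⟨ ∑-cong V (λ u → ∑-*ˡ V (D u * D u) _) ⟩
        ∑ V (λ u → D u * D u * ∑ V (λ v → ι (adj K u v))) ≡⟨ ∑-cong V (λ u → cong (D u * D u *_) (sym (deg-∑ u))) ⟩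
        ∑ V (λ u → D u * D u * D u)                       ∎

module SimpleGraph {V : Set} (_≟_ : DecidableEquality V) (G : Graph V) (simple : IsSimple G) where

  open Kronecker _≟_ public

  Vs : List V
  Vs = verts G

  E : List (V × V)
  E = edges G

  Vs-unique : Unique Vs
  Vs-unique = proj₁ simple

  adj-sym : ∀ x y → adj G x y ≡ adj G y x
  adj-sym = proj₁ (proj₂ simple)

  adj-irrefl : ∀ x → adj G x x ≡ false
  adj-irrefl = proj₂ (proj₂ simple)

  adj⇒≢ : ∀ {x y} → adj G x y ≡ true → x ≢ y
  adj⇒≢ {x} x~x refl with trans (sym x~x) (adj-irrefl x)
  ... | ()

  E-unique : Unique E
  E-unique = Unique.filter⁺ _ (pairs⁺-unique Vs Vs-unique)

  ∈-edges⁻ : ∀ {r s} → (r , s) ∈ E → adj G r s ≡ true × r ∈ Vs × s ∈ Vs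
  ∈-edges⁻ rs∈E with ∈-filter⁻ (λ (p , q) → T? (adj G p q)) rs∈E
  ... | rs∈pairs , r~s = Equivalence.to T-≡ r~s , ∈-pairs⁻ Vs rs∈pairs

  a : V → V → ℤ
  a x y = ι (adj G x y)

  d : V → ℤ
  d x = + deg G x

  Sd : V → ℤ
  Sd = nbrDegSum G

  ∑-adj : ∀ x c → ∑ Vs (λ y → a x y * c) ≡ d x * c
  ∑-adj x c = begin
    ∑ Vs (λ y → a x y * c)  ≡⟨ ∑-cong Vs (λ y → ℤ.*-comm (a x y) c) ⟩
    ∑ Vs (λ y → c * a x y)  ≡⟨ ∑-*ˡ Vs c (a x) ⟩
    c * ∑ Vs (a x)          ≡⟨ cong (c *_) (sym (deg-∑ G x)) ⟩
    c * d x                 ≡⟨ ℤ.*-comm c (d x) ⟩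
    d x * c                 ∎
    where open ≡-Reasoning

  ∑-edges : (F f : V → V → ℤ) → (∀ r s → adj G r s ≡ true → F r s ≡ f r s + f s r) →
            ∑ E (λ (r , s) → F r s) ≡ ∑ Vs (λ r → ∑ Vs (λ s → a r s * f r s))
  ∑-edges F f F≡ = begin
    ∑ E (λ (r , s) → F r s)
      ≡⟨ ∑-filterᵇ (pairs Vs) _ _ ⟩
    ∑ (pairs Vs) (λ (r , s) → a r s * F r s)
      ≡⟨ ∑-cong (pairs Vs) (λ (r , s) → symmetrise r s) ⟩
    ∑ (pairs Vs) (λ (r , s) → a r s * f r s + a s r * f s r)
      ≡⟨ sym (ℤ.+-identityʳ _) ⟩
    ∑ (pairs Vs) (λ (r , s) → a r s * f r s + a s r * f s r) + 0ℤ
      ≡⟨ cong (_+_ (∑ (pairs Vs) _))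
              (sym (trans (∑-cong Vs (λ r → cong (λ b → ι b * f r r) (adj-irrefl r))) (∑-zero Vs))) ⟩
    ∑ (pairs Vs) (λ (r , s) → a r s * f r s + a s r * f s r) + ∑ Vs (λ r → a r r * f r r)
      ≡⟨ ∑-pairs+diagonal Vs (λ r s → a r s * f r s) ⟩
    ∑ Vs (λ r → ∑ Vs (λ s → a r s * f r s))  ∎
    where
      open ≡-Reasoning
      symmetrise : ∀ r s → a r s * F r s ≡ a r s * f r s + a s r * f s r
      symmetrise r s with adj G r s in r~s
      ... | true  rewrite trans (adj-sym s r) r~s =
        trans (ℤ.*-identityˡ _) (trans (F≡ r s r~s) (sym (cong₂ _+_ (ℤ.*-identityˡ (f r s)) (ℤ.*-identityˡ (f s r)))))
      ... | false rewrite trans (adj-sym s r) r~s = refl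

  ∑∑-adj-Sd : (P : V → ℤ) → ∑ Vs (λ r → ∑ Vs (λ s → a r s * (P r * d s))) ≡ ∑ Vs (λ r → P r * Sd r)
  ∑∑-adj-Sd P = ∑-cong Vs λ r →
    trans (∑-cong Vs (λ s → rearrange (a r s) (P r) (d s))) (∑-*ˡ Vs (P r) (λ s → a r s * d s))
    where
      rearrange : ∀ i p q → i * (p * q) ≡ p * (i * q)
      rearrange = solve-∀

  handshake : + 2 * + numEdges G ≡ ∑ Vs d
  handshake = begin
    + 2 * + numEdges G                        ≡⟨ cong (+ 2 *_) (∑-length E) ⟩
    + 2 * ∑ E (λ _ → 1ℤ)                      ≡⟨ sym (∑-*ˡ E (+ 2) _) ⟩
    ∑ E (λ _ → + 2)                           ≡⟨ ∑-edges (λ _ _ → + 2) (λ _ _ → 1ℤ) (λ _ _ _ → refl) ⟩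
    ∑ Vs (λ r → ∑ Vs (λ s → a r s * 1ℤ))      ≡⟨ ∑-cong Vs (λ r → trans (∑-adj r 1ℤ) (ℤ.*-identityʳ (d r))) ⟩
    ∑ Vs d                                    ∎
    where open ≡-Reasoning

  M1²-∑ : + M1 2 G ≡ ∑ Vs (λ z → d z * d z)
  M1²-∑ = trans (∑-Σℕ Vs _) (∑-cong Vs (λ z → pos-^2 (deg G z)))

  M1³-∑ : + M1 3 G ≡ ∑ Vs (λ z → d z * d z * d z)
  M1³-∑ = trans (∑-Σℕ Vs _) (∑-cong Vs (λ z → pos-^3 (deg G z)))

  M2-∑ : + 2 * + M2 G ≡ ∑ Vs (λ r → d r * Sd r)
  M2-∑ = begin
    + 2 * + M2 G                                        ≡⟨ cong (+ 2 *_) (∑-Σℕ E _) ⟩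
    + 2 * ∑ E (λ (r , s) → + (deg G r ℕ.* deg G s))     ≡⟨ sym (∑-*ˡ E (+ 2) _) ⟩
    ∑ E (λ (r , s) → + 2 * + (deg G r ℕ.* deg G s))
      ≡⟨ ∑-edges _ (λ r s → d r * d s)
           (λ r s _ → trans (cong (+ 2 *_) (ℤ.pos-* (deg G r) (deg G s))) (double (d r) (d s))) ⟩
    ∑ Vs (λ r → ∑ Vs (λ s → a r s * (d r * d s)))       ≡⟨ ∑∑-adj-Sd d ⟩
    ∑ Vs (λ r → d r * Sd r)                             ∎
    where
      open ≡-Reasoning
      double : ∀ p q → + 2 * (p * q) ≡ p * q + q * p
      double = solve-∀

  α12-∑ : + α12 G ≡ ∑ Vs (λ r → d r * d r * Sd r)
  α12-∑ = begin
    + α12 G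
      ≡⟨ ∑-Σℕ E _ ⟩
    ∑ E (λ (r , s) → + (deg G r ℕ.* deg G s ℕ.^ 2 ℕ.+ deg G r ℕ.^ 2 ℕ.* deg G s))
      ≡⟨ ∑-edges _ (λ r s → d r * d r * d s) (λ r s _ → trans (toℤ (deg G r) (deg G s)) (swap (d r) (d s))) ⟩
    ∑ Vs (λ r → ∑ Vs (λ s → a r s * (d r * d r * d s)))
      ≡⟨ ∑∑-adj-Sd (λ r → d r * d r) ⟩
    ∑ Vs (λ r → d r * d r * Sd r)  ∎
    where
      open ≡-Reasoning
      toℤ : ∀ m n → + (m ℕ.* n ℕ.^ 2 ℕ.+ m ℕ.^ 2 ℕ.* n) ≡ + m * (+ n * + n) + + m * + m * + n
      toℤ m n = trans (ℤ.pos-+ (m ℕ.* n ℕ.^ 2) (m ℕ.^ 2 ℕ.* n))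
                  (cong₂ _+_ (trans (ℤ.pos-* m (n ℕ.^ 2)) (cong (+ m *_) (pos-^2 n)))
                             (trans (ℤ.pos-* (m ℕ.^ 2) n) (cong (_* + n) (pos-^2 m))))
      swap : ∀ p q → p * (q * q) + p * p * q ≡ p * p * q + q * q * p
      swap = solve-∀

  ∑-adjᵗ : ∀ x → ∑ Vs (λ z → a z x) ≡ d x
  ∑-adjᵗ x = trans (∑-cong Vs (λ z → cong ι (adj-sym z x))) (sym (deg-∑ G x))

  ∑-adjᵗ-d : ∀ x → ∑ Vs (λ z → a z x * d z) ≡ Sd x
  ∑-adjᵗ-d x = ∑-cong Vs (λ z → cong (λ b → ι b * d z) (adj-sym z x))

  incident : V → V × V → ℤ
  incident z (r , s) = ι (⌊ z ≟ r ⌋ ∨ ⌊ z ≟ s ⌋)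

  incident-δ : ∀ z {r s} → r ≢ s → incident z (r , s) ≡ δ z r + δ z s
  incident-δ z {r} {s} r≢s with z ≟ r | z ≟ s
  ... | yes refl | yes refl = ⊥-elim (r≢s refl)
  ... | yes _    | no _     = refl
  ... | no _     | yes _    = refl
  ... | no _     | no _     = refl

  ∑-incident : ∀ {g} → g ∈ E → (F : V → ℤ) → ∑ Vs (λ z → incident z g * F z) ≡ F (proj₁ g) + F (proj₂ g)
  ∑-incident {r , s} g∈E F with ∈-edges⁻ g∈E
  ... | r~s , r∈Vs , s∈Vs =
    trans (∑-cong Vs (λ z → cong (_* F z) (incident-δ z (adj⇒≢ r~s)))) (∑-δ+δ Vs F Vs-unique r∈Vs s∈Vs)

  ∑-incident-edges : ∀ {z} → z ∈ Vs → ∑ E (incident z) ≡ d z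
  ∑-incident-edges {z} z∈Vs = begin
    ∑ E (incident z)
      ≡⟨ ∑-edges (λ r s → incident z (r , s)) (λ r s → δ z r) (λ r s r~s → incident-δ z (adj⇒≢ r~s)) ⟩
    ∑ Vs (λ r → ∑ Vs (λ s → a r s * δ z r))
      ≡⟨ ∑-cong Vs (λ r → trans (∑-adj r (δ z r)) (trans (ℤ.*-comm (d r) (δ z r)) (cong (_* d r) (δ-sym z r)))) ⟩
    ∑ Vs (λ r → δ r z * d r)
      ≡⟨ ∑-δ Vs d Vs-unique z∈Vs ⟩
    d z  ∎
    where open ≡-Reasoning

  _≟E_ : DecidableEquality (V × V)
  _≟E_ = ×-dec _≟_ _≟_

  _≟S_ : DecidableEquality (V ⊎ (V × V))
  _≟S_ = ⊎-dec _≟_ _≟E_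

  SG : Graph (V ⊎ (V × V))
  SG = S _≟_ G

  SG-minus : V → V × V → Graph (V ⊎ (V × V))
  SG-minus x g = deleteTwo _≟S_ SG (inj₁ x) (inj₂ g)

  Θ : V → V × V → ℤ
  Θ x g = + Θ2 (SG-minus x g)

  P2Θ2-∑-edges : + P2 _≟S_ Θ2 SG ≡ ∑ E (λ g → Θ (proj₁ g) g + Θ (proj₂ g) g)
  P2Θ2-∑-edges = begin
    + P2 _≟S_ Θ2 SG
      ≡⟨ trans (∑-Σℕ (edges SG) _) (∑-filterᵇ (pairs (verts SG)) _ _) ⟩
    ∑ (pairs (map inj₁ Vs ++ map inj₂ E)) F
      ≡⟨ ∑-pairs-++ (map inj₁ Vs) (map inj₂ E) F ⟩
    ∑ (pairs (map inj₁ Vs)) F + VE + ∑ (pairs (map inj₂ E)) F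
      ≡⟨ cong₂ (λ p q → p + VE + q)
              (none inj₁ Vs (λ p q → ℤ.*-zeroˡ (+ Θ2 (deleteTwo _≟S_ SG (inj₁ p) (inj₁ q)))))
              (none inj₂ E (λ p q → ℤ.*-zeroˡ (+ Θ2 (deleteTwo _≟S_ SG (inj₂ p) (inj₂ q))))) ⟩
    0ℤ + VE + 0ℤ
      ≡⟨ trans (ℤ.+-identityʳ _) (ℤ.+-identityˡ _) ⟩
    VE
      ≡⟨ trans (∑-map Vs inj₁ _) (∑-cong Vs (λ x → ∑-map E inj₂ _)) ⟩
    ∑ Vs (λ x → ∑ E (λ g → incident x g * Θ x g))
      ≡⟨ ∑-comm Vs E _ ⟩
    ∑ E (λ g → ∑ Vs (λ x → incident x g * Θ x g))
      ≡⟨ ∑-cong-∈ E (λ g∈E → ∑-incident g∈E (λ x → Θ x _)) ⟩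
    ∑ E (λ g → Θ (proj₁ g) g + Θ (proj₂ g) g)  ∎
    where
      open ≡-Reasoning
      F : (V ⊎ (V × V)) × (V ⊎ (V × V)) → ℤ
      F (p , q) = ι (subAdj _≟_ p q) * + Θ2 (deleteTwo _≟S_ SG p q)
      VE : ℤ
      VE = ∑ (map inj₁ Vs) (λ p → ∑ (map inj₂ E) (λ q → F (p , q)))
      none : {B : Set} (inj : B → V ⊎ (V × V)) (L : List B) →
             (∀ p q → F (inj p , inj q) ≡ 0ℤ) → ∑ (pairs (map inj L)) F ≡ 0ℤ
      none inj L F≡0 = trans (∑-pairs-map inj L F) (trans (∑-cong (pairs L) (λ (p , q) → F≡0 p q)) (∑-zero (pairs L)))

  ∑-incident² : ∀ {z x} → z ∈ Vs → x ∈ Vs → ∑ E (λ g → incident z g * incident x g) ≡ δ z x * d z + a z x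
  ∑-incident² {z} {x} z∈Vs x∈Vs = begin
    ∑ E (λ g → incident z g * incident x g)
      ≡⟨ ∑-edges _ (λ r s → δ z r * (δ x r + δ x s))
           (λ r s r~s → trans (cong₂ _*_ (incident-δ z (adj⇒≢ r~s)) (incident-δ x (adj⇒≢ r~s)))
                              (split (δ z r) (δ z s) (δ x r) (δ x s))) ⟩
    ∑ Vs (λ r → ∑ Vs (λ s → a r s * (δ z r * (δ x r + δ x s))))
      ≡⟨ ∑-cong Vs inner ⟩
    ∑ Vs (λ r → δ r z * (δ x r * d r + a r x))
      ≡⟨ ∑-δ Vs (λ r → δ x r * d r + a r x) Vs-unique z∈Vs ⟩
    δ x z * d z + a z x
      ≡⟨ cong (λ t → t * d z + a z x) (δ-sym x z) ⟩
    δ z x * d z + a z x  ∎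
    where
      open ≡-Reasoning
      split : ∀ p q u v → (p + q) * (u + v) ≡ p * (u + v) + q * (v + u)
      split = solve-∀
      inner : ∀ r → ∑ Vs (λ s → a r s * (δ z r * (δ x r + δ x s))) ≡ δ r z * (δ x r * d r + a r x)
      inner r = begin
        ∑ Vs (λ s → a r s * (δ z r * (δ x r + δ x s)))
          ≡⟨ ∑-cong Vs (λ s → trans (cong (λ t → a r s * (δ z r * (δ x r + t))) (δ-sym x s))
                                   (expand (a r s) (δ z r) (δ x r) (δ s x))) ⟩
        ∑ Vs (λ s → δ z r * δ x r * a r s + δ z r * (δ s x * a r s))
          ≡⟨ ∑-+ Vs _ _ ⟩
        ∑ Vs (λ s → δ z r * δ x r * a r s) + ∑ Vs (λ s → δ z r * (δ s x * a r s))
          ≡⟨ cong₂ _+_ (trans (∑-*ˡ Vs (δ z r * δ x r) (a r)) (cong (δ z r * δ x r *_) (sym (deg-∑ G r))))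
                       (trans (∑-*ˡ Vs (δ z r) (λ s → δ s x * a r s)) (cong (δ z r *_) (∑-δ Vs (a r) Vs-unique x∈Vs))) ⟩
        δ z r * δ x r * d r + δ z r * a r x
          ≡⟨ trans (collect (δ z r) (δ x r) (d r) (a r x)) (cong (_* (δ x r * d r + a r x)) (δ-sym z r)) ⟩
        δ r z * (δ x r * d r + a r x)  ∎
        where
          expand : ∀ i p u v → i * (p * (u + v)) ≡ p * u * i + p * (v * i)
          expand = solve-∀
          collect : ∀ p u dr ax → p * u * dr + p * ax ≡ p * (u * dr + ax)
          collect = solve-∀

  κ : ℤ
  κ = + 4 * + M1 2 G + + 2 * + M2 G - + 8 * + numEdges G + + 4

  φ ψ : V → ℤ
  φ x = κ + + 10 * d x - + 4 * (d x * d x) - + 4 * Sd x - + 2 * (d x * Sd x)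
  ψ y = + 4 * d y + + 2 * Sd y

  module Deletion {x y : V} {e : V × V} (x∈Vs : x ∈ Vs) (y∈Vs : y ∈ Vs) (e∈E : e ∈ E)
                  (x~y : adj G x y ≡ true) (e-ends : ∀ z → incident z e ≡ δ z x + δ z y) where

    -- In K, D₁ z and D₂ g are the degrees of the old vertex z and the new vertex g, N₁ z and N₂ g their
    -- neighbour-degree sums, and A z is D₁ z except that A x = 0 since x is deleted.
    K : Graph (V ⊎ (V × V))
    K = SG-minus x e

    K-adj-sym : ∀ u w → adj K u w ≡ adj K w u
    K-adj-sym (inj₁ _) (inj₁ _) = refl
    K-adj-sym (inj₁ _) (inj₂ _) = refl
    K-adj-sym (inj₂ _) (inj₁ _) = refl
    K-adj-sym (inj₂ _) (inj₂ _) = refl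

    x≢y : x ≢ y
    x≢y = adj⇒≢ x~y

    δ-x-x : δ x x ≡ 1ℤ
    δ-x-x = δ-refl x

    δ-x-y : δ x y ≡ 0ℤ
    δ-x-y = δ-≢ x≢y

    δ-y-x : δ y x ≡ 0ℤ
    δ-y-x = δ-≢ (x≢y ∘ sym)

    δ-y-y : δ y y ≡ 1ℤ
    δ-y-y = δ-refl y

    a-y-x : a y x ≡ 1ℤ
    a-y-x = cong ι (trans (adj-sym y x) x~y)

    ∑-K : (f : V ⊎ (V × V) → ℤ) →
          ∑ (verts K) f ≡ (∑ Vs (f ∘ inj₁) - f (inj₁ x)) + (∑ E (f ∘ inj₂) - f (inj₂ e))
    ∑-K f = begin
      ∑ (verts K) f
        ≡⟨ ∑-filterᵇ (map inj₁ Vs ++ map inj₂ E) kept f ⟩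
      ∑ (map inj₁ Vs ++ map inj₂ E) (λ w → ι (kept w) * f w)
        ≡⟨ ∑-++ (map inj₁ Vs) (map inj₂ E) _ ⟩
      ∑ (map inj₁ Vs) (λ w → ι (kept w) * f w) + ∑ (map inj₂ E) (λ w → ι (kept w) * f w)
        ≡⟨ cong₂ _+_ (∑-map Vs inj₁ _) (∑-map E inj₂ _) ⟩
      ∑ Vs (λ z → ι (kept (inj₁ z)) * f (inj₁ z)) + ∑ E (λ g → ι (kept (inj₂ g)) * f (inj₂ g))
        ≡⟨ cong₂ _+_
             (trans (∑-cong Vs (λ z → cong (_* f (inj₁ z)) (kept-old z))) (∑-without Vs (f ∘ inj₁) Vs-unique x∈Vs))
             (trans (∑-cong E (λ g → cong (_* f (inj₂ g)) (kept-new g)))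
                    (Kronecker.∑-without _≟E_ E (f ∘ inj₂) E-unique e∈E)) ⟩
      (∑ Vs (f ∘ inj₁) - f (inj₁ x)) + (∑ E (f ∘ inj₂) - f (inj₂ e))  ∎
      where
        open ≡-Reasoning
        kept : V ⊎ (V × V) → Bool
        kept w = not ⌊ w ≟S inj₁ x ⌋ ∧ not ⌊ w ≟S inj₂ e ⌋
        kept-old : ∀ z → ι (kept (inj₁ z)) ≡ 1ℤ - δ z x
        kept-old z = trans (cong ι (trans (∧-identityʳ _) (cong not (⌊⌋-map′ _ _ (z ≟ x))))) (ι-not ⌊ z ≟ x ⌋)
        kept-new : ∀ g → ι (kept (inj₂ g)) ≡ 1ℤ - Kronecker.δ _≟E_ g e
        kept-new g = trans (cong (ι ∘ not) (⌊⌋-map′ _ _ (g ≟E e))) (ι-not ⌊ g ≟E e ⌋)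

    ∑-K-by-parts : (f : V ⊎ (V × V) → ℤ) (F₁ : V → ℤ) (F₂ : V × V → ℤ) →
                   (∀ {z} → z ∈ Vs → f (inj₁ z) ≡ F₁ z) → (∀ {g} → g ∈ E → f (inj₂ g) ≡ F₂ g) →
                   ∑ (verts K) f ≡ (∑ Vs F₁ - F₁ x) + (∑ E F₂ - F₂ e)
    ∑-K-by-parts f F₁ F₂ f≡F₁ f≡F₂ =
      trans (∑-K f) (cong₂ _+_ (cong₂ _-_ (∑-cong-∈ Vs f≡F₁) (f≡F₁ x∈Vs))
                               (cong₂ _-_ (∑-cong-∈ E f≡F₂) (f≡F₂ e∈E)))

    D₁ : V → ℤ
    D₁ z = d z - δ z x - δ z y

    D₂ : V × V → ℤ
    D₂ g = + 2 - incident x g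

    D₁-y : D₁ y ≡ d y - 1ℤ
    D₁-y = trans (cong₂ (λ p q → d y - p - q) δ-y-x δ-y-y) (cong (_- 1ℤ) (ℤ.+-identityʳ (d y)))

    D₁-elsewhere : ∀ z → z ≢ x → z ≢ y → D₁ z ≡ d z
    D₁-elsewhere z z≢x z≢y =
      trans (cong₂ (λ p q → d z - p - q) (δ-≢ z≢x) (δ-≢ z≢y)) (trans (ℤ.+-identityʳ _) (ℤ.+-identityʳ _))

    D₂-e : D₂ e ≡ 1ℤ
    D₂-e = cong (_-_ (+ 2)) (trans (e-ends x) (cong₂ _+_ δ-x-x δ-x-y))

    deg-K-old : ∀ {z} → z ∈ Vs → + deg K (inj₁ z) ≡ D₁ z
    deg-K-old {z} z∈Vs = begin
      + deg K (inj₁ z)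
        ≡⟨ trans (deg-∑ K (inj₁ z)) (∑-K _) ⟩
      (∑ Vs (λ _ → 0ℤ) - 0ℤ) + (∑ E (incident z) - incident z e)
        ≡⟨ cong₂ (λ p q → (p - 0ℤ) + (q - incident z e)) (∑-zero Vs) (∑-incident-edges z∈Vs) ⟩
      (0ℤ - 0ℤ) + (d z - incident z e)
        ≡⟨ cong (λ i → (0ℤ - 0ℤ) + (d z - i)) (e-ends z) ⟩
      (0ℤ - 0ℤ) + (d z - (δ z x + δ z y))
        ≡⟨ simplify (d z) (δ z x) (δ z y) ⟩
      D₁ z  ∎
      where
        open ≡-Reasoning
        simplify : ∀ p q r → (0ℤ - 0ℤ) + (p - (q + r)) ≡ p - q - r
        simplify = solve-∀

    deg-K-new : ∀ {g} → g ∈ E → + deg K (inj₂ g) ≡ D₂ g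
    deg-K-new {g} g∈E = begin
      + deg K (inj₂ g)
        ≡⟨ trans (deg-∑ K (inj₂ g)) (∑-K _) ⟩
      (∑ Vs (λ z → incident z g) - incident x g) + (∑ E (λ _ → 0ℤ) - 0ℤ)
        ≡⟨ cong₂ (λ p q → (p - incident x g) + (q - 0ℤ)) two (∑-zero E) ⟩
      (+ 2 - incident x g) + (0ℤ - 0ℤ)
        ≡⟨ ℤ.+-identityʳ _ ⟩
      D₂ g  ∎
      where
        open ≡-Reasoning
        two : ∑ Vs (λ z → incident z g) ≡ + 2
        two = trans (sym (∑-cong Vs (λ z → ℤ.*-identityʳ (incident z g)))) (∑-incident g∈E (λ _ → 1ℤ))

    N₁ : V → ℤ
    N₁ z = (+ 2 - δ z x) * d z - a z x - (δ z x + δ z y)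

    nbr-K-old : ∀ {z} → z ∈ Vs → nbrDegSum K (inj₁ z) ≡ N₁ z
    nbr-K-old {z} z∈Vs = begin
      nbrDegSum K (inj₁ z)
        ≡⟨ ∑-K-by-parts _ (λ _ → 0ℤ) (λ g → incident z g * D₂ g)
             (λ {w} _ → ℤ.*-zeroˡ (+ deg K (inj₁ w))) (λ g∈E → cong (incident z _ *_) (deg-K-new g∈E)) ⟩
      (∑ Vs (λ _ → 0ℤ) - 0ℤ) + (∑ E (λ g → incident z g * D₂ g) - incident z e * D₂ e)
        ≡⟨ cong₂ (λ p q → (p - 0ℤ) + q) (∑-zero Vs) (cong₂ _-_ edge-sum (cong₂ _*_ (e-ends z) D₂-e)) ⟩
      (0ℤ - 0ℤ) + (+ 2 * d z + - 1ℤ * (δ z x * d z + a z x) - (δ z x + δ z y) * 1ℤ)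
        ≡⟨ simplify (d z) (δ z x) (δ z y) (a z x) ⟩
      N₁ z  ∎
      where
        open ≡-Reasoning
        simplify : ∀ p u v i → (0ℤ - 0ℤ) + (+ 2 * p + - 1ℤ * (u * p + i) - (u + v) * 1ℤ) ≡ (+ 2 - u) * p - i - (u + v)
        simplify = solve-∀
        edge-sum : ∑ E (λ g → incident z g * D₂ g) ≡ + 2 * d z + - 1ℤ * (δ z x * d z + a z x)
        edge-sum = begin
          ∑ E (λ g → incident z g * D₂ g)
            ≡⟨ ∑-cong E (λ g → expand (incident z g) (incident x g)) ⟩
          ∑ E (λ g → + 2 * incident z g + - 1ℤ * (incident z g * incident x g))
            ≡⟨ trans (∑-+ E (λ g → + 2 * incident z g) _) (cong₂ _+_ (∑-*ˡ E (+ 2) _) (∑-*ˡ E (- 1ℤ) _)) ⟩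
          + 2 * ∑ E (incident z) + - 1ℤ * ∑ E (λ g → incident z g * incident x g)
            ≡⟨ cong₂ (λ p q → + 2 * p + - 1ℤ * q) (∑-incident-edges z∈Vs) (∑-incident² z∈Vs x∈Vs) ⟩
          + 2 * d z + - 1ℤ * (δ z x * d z + a z x)  ∎
          where
            expand : ∀ i j → i * (+ 2 - j) ≡ + 2 * i + - 1ℤ * (i * j)
            expand = solve-∀

    N₁-y : N₁ y ≡ + 2 * d y - + 2
    N₁-y = begin
      (+ 2 - δ y x) * d y - a y x - (δ y x + δ y y)  ≡⟨ cong₂ (λ p q → (+ 2 - p) * d y - q - (p + δ y y)) δ-y-x a-y-x ⟩
      (+ 2 - 0ℤ) * d y - 1ℤ - (0ℤ + δ y y)         ≡⟨ cong (λ p → (+ 2 - 0ℤ) * d y - 1ℤ - (0ℤ + p)) δ-y-y ⟩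
      (+ 2 - 0ℤ) * d y - 1ℤ - (0ℤ + 1ℤ)             ≡⟨ simplify (d y) ⟩
      + 2 * d y - + 2                                ∎
      where
        open ≡-Reasoning
        simplify : ∀ p → (+ 2 - 0ℤ) * p - 1ℤ - (0ℤ + 1ℤ) ≡ + 2 * p - + 2
        simplify = solve-∀

    N₁-elsewhere : ∀ z → z ≢ x → z ≢ y → N₁ z ≡ + 2 * d z - a z x
    N₁-elsewhere z z≢x z≢y = begin
      (+ 2 - δ z x) * d z - a z x - (δ z x + δ z y)
        ≡⟨ cong₂ (λ p q → (+ 2 - p) * d z - a z x - (p + q)) (δ-≢ z≢x) (δ-≢ z≢y) ⟩
      (+ 2 - 0ℤ) * d z - a z x - (0ℤ + 0ℤ)          ≡⟨ simplify (d z) (a z x) ⟩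
      + 2 * d z - a z x                              ∎
      where
        open ≡-Reasoning
        simplify : ∀ p q → (+ 2 - 0ℤ) * p - q - (0ℤ + 0ℤ) ≡ + 2 * p - q
        simplify = solve-∀

    A : V → ℤ
    A z = (1ℤ - δ z x) * D₁ z

    nbr-K-new : ∀ {g} → g ∈ E → nbrDegSum K (inj₂ g) ≡ A (proj₁ g) + A (proj₂ g)
    nbr-K-new {g} g∈E = begin
      nbrDegSum K (inj₂ g)
        ≡⟨ ∑-K-by-parts _ (λ z → incident z g * D₁ z) (λ _ → 0ℤ)
             (λ z∈Vs → cong (incident _ g *_) (deg-K-old z∈Vs)) (λ {h} _ → ℤ.*-zeroˡ (+ deg K (inj₂ h))) ⟩
      (∑ Vs (λ z → incident z g * D₁ z) - incident x g * D₁ x) + (∑ E (λ _ → 0ℤ) - 0ℤ)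
        ≡⟨ cong₂ _+_ (sym (∑-without Vs (λ z → incident z g * D₁ z) Vs-unique x∈Vs)) (cong (_- 0ℤ) (∑-zero E)) ⟩
      ∑ Vs (λ z → (1ℤ - δ z x) * (incident z g * D₁ z)) + (0ℤ - 0ℤ)
        ≡⟨ trans (ℤ.+-identityʳ _) (∑-cong Vs (λ z → rearrange (δ z x) (incident z g) (D₁ z))) ⟩
      ∑ Vs (λ z → incident z g * A z)
        ≡⟨ ∑-incident g∈E A ⟩
      A (proj₁ g) + A (proj₂ g)  ∎
      where
        open ≡-Reasoning
        rearrange : ∀ p i q → (1ℤ - p) * (i * q) ≡ i * ((1ℤ - p) * q)
        rearrange = solve-∀

    A-x : A x ≡ 0ℤ
    A-x = trans (cong (λ p → (1ℤ - p) * D₁ x) δ-x-x) (vanish (D₁ x))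
      where
        vanish : ∀ t → (1ℤ - 1ℤ) * t ≡ 0ℤ
        vanish = solve-∀

    A-y : A y ≡ d y - 1ℤ
    A-y = trans (cong₂ (λ p q → (1ℤ - p) * q) δ-y-x D₁-y) (ℤ.*-identityˡ _)

    A-elsewhere : ∀ z → z ≢ x → z ≢ y → A z ≡ d z
    A-elsewhere z z≢x z≢y =
      trans (cong₂ (λ p q → (1ℤ - p) * q) (δ-≢ z≢x) (D₁-elsewhere z z≢x z≢y)) (ℤ.*-identityˡ _)

    N₂ : V × V → ℤ
    N₂ (r , s) = A r + A s

    ends-sum : (F : V → ℤ) → F (proj₁ e) + F (proj₂ e) ≡ F x + F y
    ends-sum F = trans (sym (∑-incident e∈E F))
                       (trans (∑-cong Vs (λ z → cong (_* F z) (e-ends z))) (∑-δ+δ Vs F Vs-unique x∈Vs y∈Vs))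

    ∑-N₁² : ∑ Vs (λ z → N₁ z * N₁ z) - N₁ x * N₁ x
          ≡ + 4 * + M1 2 G - + 4 * Sd x + d x - + 4 * (d x * d x) - + 4 * d y + + 3
    ∑-N₁² = begin
      ∑ Vs F - F x
        ≡⟨ cong (_- F x) (∑-agree-except₂ Vs F Gen Vs-unique x∈Vs y∈Vs x≢y
                            (λ z z≢x z≢y → cong (λ t → t * t) (N₁-elsewhere z z≢x z≢y))) ⟩
      ∑ Vs Gen + (F x - Gen x) + (F y - Gen y) - F x
        ≡⟨ cong (_- F x) (cong₂ _+_ (cong₂ (λ p q → p + (F x - q)) ∑-Gen Gen-x)
                                    (cong₂ _-_ (cong (λ t → t * t) N₁-y) Gen-y)) ⟩
      (+ 4 * + M1 2 G - + 4 * Sd x + d x) + (F x - (+ 2 * d x - 0ℤ) * (+ 2 * d x - 0ℤ))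
        + ((+ 2 * d y - + 2) * (+ 2 * d y - + 2) - (+ 2 * d y - 1ℤ) * (+ 2 * d y - 1ℤ)) - F x
        ≡⟨ cancel (+ 4 * + M1 2 G - + 4 * Sd x + d x) (F x) (d x) (d y) ⟩
      + 4 * + M1 2 G - + 4 * Sd x + d x - + 4 * (d x * d x) - + 4 * d y + + 3  ∎
      where
        open ≡-Reasoning
        F Gen : V → ℤ
        F z = N₁ z * N₁ z
        Gen z = (+ 2 * d z - a z x) * (+ 2 * d z - a z x)
        Gen-x : Gen x ≡ (+ 2 * d x - 0ℤ) * (+ 2 * d x - 0ℤ)
        Gen-x = cong (λ b → (+ 2 * d x - ι b) * (+ 2 * d x - ι b)) (adj-irrefl x)
        Gen-y : Gen y ≡ (+ 2 * d y - 1ℤ) * (+ 2 * d y - 1ℤ)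
        Gen-y = cong (λ t → (+ 2 * d y - t) * (+ 2 * d y - t)) a-y-x
        expand : ∀ p i → i * i ≡ i → (+ 2 * p - i) * (+ 2 * p - i) ≡ + 4 * (p * p) + (- + 4 * (i * p) + i)
        expand p i i²≡i = trans (square p i) (cong (λ t → + 4 * (p * p) + (- + 4 * (i * p) + t)) i²≡i)
          where
            square : ∀ p i → (+ 2 * p - i) * (+ 2 * p - i) ≡ + 4 * (p * p) + (- + 4 * (i * p) + i * i)
            square = solve-∀
        ∑-Gen : ∑ Vs Gen ≡ + 4 * + M1 2 G - + 4 * Sd x + d x
        ∑-Gen = begin
          ∑ Vs Gen
            ≡⟨ ∑-cong Vs (λ z → expand (d z) (a z x) (ι-idem (adj G z x))) ⟩
          ∑ Vs (λ z → + 4 * (d z * d z) + (- + 4 * (a z x * d z) + a z x))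
            ≡⟨ trans (∑-+ Vs (λ z → + 4 * (d z * d z)) _)
                     (cong (_+_ (∑ Vs (λ z → + 4 * (d z * d z)))) (∑-+ Vs (λ z → - + 4 * (a z x * d z)) (λ z → a z x))) ⟩
          ∑ Vs (λ z → + 4 * (d z * d z)) + (∑ Vs (λ z → - + 4 * (a z x * d z)) + ∑ Vs (λ z → a z x))
            ≡⟨ cong₂ (λ p q → p + (q + ∑ Vs (λ z → a z x))) (∑-*ˡ Vs (+ 4) _) (∑-*ˡ Vs (- + 4) _) ⟩
          + 4 * ∑ Vs (λ z → d z * d z) + (- + 4 * ∑ Vs (λ z → a z x * d z) + ∑ Vs (λ z → a z x))
            ≡⟨ cong₂ (λ p q → + 4 * p + q) (sym M1²-∑) (cong₂ (λ p q → - + 4 * p + q) (∑-adjᵗ-d x) (∑-adjᵗ x)) ⟩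
          + 4 * + M1 2 G + (- + 4 * Sd x + d x)
            ≡⟨ tidy (+ M1 2 G) (Sd x) (d x) ⟩
          + 4 * + M1 2 G - + 4 * Sd x + d x  ∎
          where
            tidy : ∀ m s p → + 4 * m + (- + 4 * s + p) ≡ + 4 * m - + 4 * s + p
            tidy = solve-∀
        cancel : ∀ c f p q → c + (f - (+ 2 * p - 0ℤ) * (+ 2 * p - 0ℤ))
                               + ((+ 2 * q - + 2) * (+ 2 * q - + 2) - (+ 2 * q - 1ℤ) * (+ 2 * q - 1ℤ)) - f
                           ≡ c - + 4 * (p * p) - + 4 * q + + 3
        cancel = solve-∀

    B : V → ℤ
    B r = ∑ Vs (λ s → a r s * A s)

    B-value : ∀ r → B r ≡ Sd r - a r x * d x - a r y
    B-value r = begin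
      B r
        ≡⟨ ∑-agree-except₂ Vs (λ s → a r s * A s) (λ s → a r s * d s) Vs-unique x∈Vs y∈Vs x≢y
             (λ s s≢x s≢y → cong (a r s *_) (A-elsewhere s s≢x s≢y)) ⟩
      Sd r + (a r x * A x - a r x * d x) + (a r y * A y - a r y * d y)
        ≡⟨ cong₂ (λ p q → Sd r + (a r x * p - a r x * d x) + (a r y * q - a r y * d y)) A-x A-y ⟩
      Sd r + (a r x * 0ℤ - a r x * d x) + (a r y * (d y - 1ℤ) - a r y * d y)
        ≡⟨ simplify (Sd r) (a r x) (a r y) (d x) (d y) ⟩
      Sd r - a r x * d x - a r y  ∎
      where
        open ≡-Reasoning
        simplify : ∀ s i j p q → s + (i * 0ℤ - i * p) + (j * (q - 1ℤ) - j * q) ≡ s - i * p - j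
        simplify = solve-∀

    B-x : B x ≡ Sd x - 1ℤ
    B-x = trans (B-value x) (trans (cong₂ (λ p q → Sd x - ι p * d x - ι q) (adj-irrefl x) x~y) (simplify (Sd x) (d x)))
      where
        simplify : ∀ s p → s - 0ℤ * p - 1ℤ ≡ s - 1ℤ
        simplify = solve-∀

    B-y : B y ≡ Sd y - d x
    B-y = trans (B-value y) (trans (cong₂ (λ p q → Sd y - p * d x - ι q) a-y-x (adj-irrefl y)) (simplify (Sd y) (d x)))
      where
        simplify : ∀ s p → s - 1ℤ * p - 0ℤ ≡ s - p
        simplify = solve-∀

    ∑-N₂² : ∑ E (λ g → N₂ g * N₂ g) - N₂ e * N₂ e
          ≡ + M1 3 G + + 2 * + M2 G - + 2 * (d x * Sd x) - d x * d x * d x + + 2 * d x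
            - + 3 * (d y * d y) + + 3 * d y - 1ℤ - + 2 * Sd y
    ∑-N₂² = begin
      ∑ E (λ g → N₂ g * N₂ g) - N₂ e * N₂ e
        ≡⟨ cong₂ _-_ (∑-edges _ (λ r s → A r * A r + A r * A s) (λ r s _ → square (A r) (A s)))
                     (cong (λ t → t * t) (trans (ends-sum A) (cong₂ _+_ A-x A-y))) ⟩
      ∑ Vs (λ r → ∑ Vs (λ s → a r s * (A r * A r + A r * A s))) - (0ℤ + (d y - 1ℤ)) * (0ℤ + (d y - 1ℤ))
        ≡⟨ cong (_- (0ℤ + (d y - 1ℤ)) * (0ℤ + (d y - 1ℤ))) (∑-cong Vs inner) ⟩
      ∑ Vs F - (0ℤ + (d y - 1ℤ)) * (0ℤ + (d y - 1ℤ))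
        ≡⟨ cong (_- (0ℤ + (d y - 1ℤ)) * (0ℤ + (d y - 1ℤ)))
             (∑-agree-except₂ Vs F Gen Vs-unique x∈Vs y∈Vs x≢y
               (λ z z≢x z≢y → cong (λ t → d z * (t * t) + t * B z) (A-elsewhere z z≢x z≢y))) ⟩
      ∑ Vs Gen + (F x - Gen x) + (F y - Gen y) - (0ℤ + (d y - 1ℤ)) * (0ℤ + (d y - 1ℤ))
        ≡⟨ cong₂ (λ p q → p + q + (F y - Gen y) - (0ℤ + (d y - 1ℤ)) * (0ℤ + (d y - 1ℤ))) ∑-Gen
             (cong₂ (λ p q → d x * (p * p) + p * q - (d x * (d x * d x) + d x * q)) A-x B-x) ⟩
      + M1 3 G + + 2 * + M2 G - d x * Sd x - Sd y
        + (d x * (0ℤ * 0ℤ) + 0ℤ * (Sd x - 1ℤ) - (d x * (d x * d x) + d x * (Sd x - 1ℤ)))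
        + (F y - Gen y) - (0ℤ + (d y - 1ℤ)) * (0ℤ + (d y - 1ℤ))
        ≡⟨ cong (λ t → + M1 3 G + + 2 * + M2 G - d x * Sd x - Sd y
                       + (d x * (0ℤ * 0ℤ) + 0ℤ * (Sd x - 1ℤ) - (d x * (d x * d x) + d x * (Sd x - 1ℤ)))
                       + t - (0ℤ + (d y - 1ℤ)) * (0ℤ + (d y - 1ℤ)))
             (cong₂ (λ p q → d y * (p * p) + p * q - (d y * (d y * d y) + d y * q)) A-y B-y) ⟩
      + M1 3 G + + 2 * + M2 G - d x * Sd x - Sd y
        + (d x * (0ℤ * 0ℤ) + 0ℤ * (Sd x - 1ℤ) - (d x * (d x * d x) + d x * (Sd x - 1ℤ)))
        + (d y * ((d y - 1ℤ) * (d y - 1ℤ)) + (d y - 1ℤ) * (Sd y - d x) - (d y * (d y * d y) + d y * (Sd y - d x)))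
        - (0ℤ + (d y - 1ℤ)) * (0ℤ + (d y - 1ℤ))
        ≡⟨ simplify (+ M1 3 G) (+ M2 G) (d x) (d y) (Sd x) (Sd y) ⟩
      + M1 3 G + + 2 * + M2 G - + 2 * (d x * Sd x) - d x * d x * d x + + 2 * d x
        - + 3 * (d y * d y) + + 3 * d y - 1ℤ - + 2 * Sd y  ∎
      where
        open ≡-Reasoning
        square : ∀ p q → (p + q) * (p + q) ≡ (p * p + p * q) + (q * q + q * p)
        square = solve-∀
        F Gen : V → ℤ
        F r = d r * (A r * A r) + A r * B r
        Gen r = d r * (d r * d r) + d r * B r
        inner : ∀ r → ∑ Vs (λ s → a r s * (A r * A r + A r * A s)) ≡ F r
        inner r = begin
          ∑ Vs (λ s → a r s * (A r * A r + A r * A s))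
            ≡⟨ ∑-cong Vs (λ s → distribute (a r s) (A r) (A s)) ⟩
          ∑ Vs (λ s → a r s * (A r * A r) + A r * (a r s * A s))
            ≡⟨ ∑-+ Vs _ _ ⟩
          ∑ Vs (λ s → a r s * (A r * A r)) + ∑ Vs (λ s → A r * (a r s * A s))
            ≡⟨ cong₂ _+_ (∑-adj r (A r * A r)) (∑-*ˡ Vs (A r) _) ⟩
          F r  ∎
          where
            distribute : ∀ i p q → i * (p * p + p * q) ≡ i * (p * p) + p * (i * q)
            distribute = solve-∀
        ∑-Gen : ∑ Vs Gen ≡ + M1 3 G + + 2 * + M2 G - d x * Sd x - Sd y
        ∑-Gen = begin
          ∑ Vs Gen
            ≡⟨ ∑-cong Vs (λ r → trans (cong (λ t → d r * (d r * d r) + d r * t) (B-value r))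
                                     (expand (d r) (Sd r) (a r x) (a r y) (d x))) ⟩
          ∑ Vs (λ r → cube r + (f r - d x * g r - h r))
            ≡⟨ ∑-+ Vs cube _ ⟩
          ∑ Vs cube + ∑ Vs (λ r → f r - d x * g r - h r)
            ≡⟨ cong (_+_ (∑ Vs cube)) (trans (∑-- Vs (λ r → f r - d x * g r) h)
                                             (cong (_- ∑ Vs h) (trans (∑-- Vs f _) (cong (_-_ (∑ Vs f)) (∑-*ˡ Vs (d x) g))))) ⟩
          ∑ Vs cube + (∑ Vs f - d x * ∑ Vs g - ∑ Vs h)
            ≡⟨ cong₂ (λ p q → p + (q - d x * ∑ Vs g - ∑ Vs h)) (sym M1³-∑) (sym M2-∑) ⟩
          + M1 3 G + (+ 2 * + M2 G - d x * ∑ Vs g - ∑ Vs h)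
            ≡⟨ cong₂ (λ p q → + M1 3 G + (+ 2 * + M2 G - d x * p - q)) (∑-adjᵗ-d x) (∑-adjᵗ-d y) ⟩
          + M1 3 G + (+ 2 * + M2 G - d x * Sd x - Sd y)
            ≡⟨ tidy (+ M1 3 G) (+ 2 * + M2 G) (d x * Sd x) (Sd y) ⟩
          + M1 3 G + + 2 * + M2 G - d x * Sd x - Sd y  ∎
          where
            cube f g h : V → ℤ
            cube r = d r * d r * d r
            f r = d r * Sd r
            g r = a r x * d r
            h r = a r y * d r
            expand : ∀ p s i j q → p * (p * p) + p * (s - i * q - j) ≡ p * p * p + (p * s - q * (i * p) - j * p)
            expand = solve-∀
            tidy : ∀ c m u v → c + (m - u - v) ≡ c + m - u - v
            tidy = solve-∀
        simplify : ∀ c m p q s t →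
          c + + 2 * m - p * s - t + (p * (0ℤ * 0ℤ) + 0ℤ * (s - 1ℤ) - (p * (p * p) + p * (s - 1ℤ)))
            + (q * ((q - 1ℤ) * (q - 1ℤ)) + (q - 1ℤ) * (t - p) - (q * (q * q) + q * (t - p)))
            - (0ℤ + (q - 1ℤ)) * (0ℤ + (q - 1ℤ))
          ≡ c + + 2 * m - + 2 * (p * s) - p * p * p + + 2 * p - + 3 * (q * q) + + 3 * q - 1ℤ - + 2 * t
        simplify = solve-∀

    ∑-D₁³ : ∑ Vs (λ z → D₁ z * D₁ z * D₁ z) - D₁ x * D₁ x * D₁ x
          ≡ + M1 3 G - d x * d x * d x - + 3 * (d y * d y) + + 3 * d y - 1ℤ
    ∑-D₁³ = begin
      ∑ Vs F - F x
        ≡⟨ cong (_- F x) (∑-agree-except₂ Vs F (λ z → d z * d z * d z) Vs-unique x∈Vs y∈Vs x≢y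
                            (λ z z≢x z≢y → cong (λ t → t * t * t) (D₁-elsewhere z z≢x z≢y))) ⟩
      ∑ Vs (λ z → d z * d z * d z) + (F x - d x * d x * d x) + (F y - d y * d y * d y) - F x
        ≡⟨ cong₂ (λ p q → p + (F x - d x * d x * d x) + (q - d y * d y * d y) - F x)
                 (sym M1³-∑) (cong (λ t → t * t * t) D₁-y) ⟩
      + M1 3 G + (F x - d x * d x * d x) + ((d y - 1ℤ) * (d y - 1ℤ) * (d y - 1ℤ) - d y * d y * d y) - F x
        ≡⟨ cancel (+ M1 3 G) (F x) (d x) (d y) ⟩
      + M1 3 G - d x * d x * d x - + 3 * (d y * d y) + + 3 * d y - 1ℤ  ∎
      where
        open ≡-Reasoning
        F : V → ℤ
        F z = D₁ z * D₁ z * D₁ z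
        cancel : ∀ c f p q → c + (f - p * p * p) + ((q - 1ℤ) * (q - 1ℤ) * (q - 1ℤ) - q * q * q) - f
                           ≡ c - p * p * p - + 3 * (q * q) + + 3 * q - 1ℤ
        cancel = solve-∀

    ∑-D₂³ : ∑ E (λ g → D₂ g * D₂ g * D₂ g) - D₂ e * D₂ e * D₂ e ≡ + 8 * + numEdges G - + 7 * d x - 1ℤ
    ∑-D₂³ = begin
      ∑ E (λ g → D₂ g * D₂ g * D₂ g) - D₂ e * D₂ e * D₂ e
        ≡⟨ cong₂ _-_ (∑-cong E (λ g → cube-2-ι (⌊ x ≟ proj₁ g ⌋ ∨ ⌊ x ≟ proj₂ g ⌋)))
                     (cong (λ t → t * t * t) D₂-e) ⟩
      ∑ E (λ g → + 8 * 1ℤ - + 7 * incident x g) - 1ℤ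
        ≡⟨ cong (_- 1ℤ) (trans (∑---* E _ (+ 7) (incident x)) (cong (_- + 7 * ∑ E (incident x)) (∑-*ˡ E (+ 8) _))) ⟩
      + 8 * ∑ E (λ _ → 1ℤ) - + 7 * ∑ E (incident x) - 1ℤ
        ≡⟨ cong₂ (λ p q → + 8 * p - + 7 * q - 1ℤ) (sym (∑-length E)) (∑-incident-edges x∈Vs) ⟩
      + 8 * + numEdges G - + 7 * d x - 1ℤ  ∎
      where
        open ≡-Reasoning
        cube-2-ι : ∀ b → (+ 2 - ι b) * (+ 2 - ι b) * (+ 2 - ι b) ≡ + 8 * 1ℤ - + 7 * ι b
        cube-2-ι true  = refl
        cube-2-ι false = refl

    2Θ-value : + 2 * Θ x e ≡ φ x - ψ y
    2Θ-value = begin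
      + 2 * Θ x e
        ≡⟨ isolate (+ 2 * Θ x e) (∑ (verts K) cube) ⟩
      (+ 2 * Θ x e + ∑ (verts K) cube) - ∑ (verts K) cube
        ≡⟨ cong₂ _-_ (trans (Θ2-nbrDegSum K K-adj-sym) ∑-squares) ∑-cubes ⟩
      (+ 4 * + M1 2 G - + 4 * Sd x + d x - + 4 * (d x * d x) - + 4 * d y + + 3)
      + (+ M1 3 G + + 2 * + M2 G - + 2 * (d x * Sd x) - d x * d x * d x + + 2 * d x
         - + 3 * (d y * d y) + + 3 * d y - 1ℤ - + 2 * Sd y)
      - ((+ M1 3 G - d x * d x * d x - + 3 * (d y * d y) + + 3 * d y - 1ℤ) + (+ 8 * + numEdges G - + 7 * d x - 1ℤ))
        ≡⟨ simplify (+ M1 2 G) (+ M1 3 G) (+ M2 G) (+ numEdges G) (d x) (d y) (Sd x) (Sd y) ⟩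
      φ x - ψ y  ∎
      where
        open ≡-Reasoning
        cube : V ⊎ (V × V) → ℤ
        cube v = + deg K v * + deg K v * + deg K v
        isolate : ∀ t c → t ≡ (t + c) - c
        isolate = solve-∀
        ∑-cubes : ∑ (verts K) cube
                ≡ (+ M1 3 G - d x * d x * d x - + 3 * (d y * d y) + + 3 * d y - 1ℤ) + (+ 8 * + numEdges G - + 7 * d x - 1ℤ)
        ∑-cubes = trans (∑-K-by-parts cube _ _ (λ z∈Vs → cong (λ t → t * t * t) (deg-K-old z∈Vs))
                                               (λ g∈E → cong (λ t → t * t * t) (deg-K-new g∈E)))
                        (cong₂ _+_ ∑-D₁³ ∑-D₂³)
        ∑-squares : ∑ (verts K) (λ v → nbrDegSum K v * nbrDegSum K v)
                  ≡ (+ 4 * + M1 2 G - + 4 * Sd x + d x - + 4 * (d x * d x) - + 4 * d y + + 3)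
                    + (+ M1 3 G + + 2 * + M2 G - + 2 * (d x * Sd x) - d x * d x * d x + + 2 * d x
                       - + 3 * (d y * d y) + + 3 * d y - 1ℤ - + 2 * Sd y)
        ∑-squares = trans (∑-K-by-parts _ _ _ (λ z∈Vs → cong (λ t → t * t) (nbr-K-old z∈Vs))
                                              (λ g∈E → cong (λ t → t * t) (nbr-K-new g∈E)))
                          (cong₂ _+_ ∑-N₁² ∑-N₂²)
        simplify : ∀ m₁₂ m₁₃ m₂ m p q s t →
          (+ 4 * m₁₂ - + 4 * s + p - + 4 * (p * p) - + 4 * q + + 3)
          + (m₁₃ + + 2 * m₂ - + 2 * (p * s) - p * p * p + + 2 * p - + 3 * (q * q) + + 3 * q - 1ℤ - + 2 * t)
          - ((m₁₃ - p * p * p - + 3 * (q * q) + + 3 * q - 1ℤ) + (+ 8 * m - + 7 * p - 1ℤ))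
          ≡ (+ 4 * m₁₂ + + 2 * m₂ - + 8 * m + + 4 + + 10 * p - + 4 * (p * p) - + 4 * s - + 2 * (p * s))
            - (+ 4 * q + + 2 * t)
        simplify = solve-∀

  2Θ-ends : ∀ {r s} → (r , s) ∈ E → + 2 * (Θ r (r , s) + Θ s (r , s)) ≡ (φ r - ψ s) + (φ s - ψ r)
  2Θ-ends {r} {s} rs∈E with ∈-edges⁻ rs∈E
  ... | r~s , r∈Vs , s∈Vs =
    trans (ℤ.*-distribˡ-+ (+ 2) (Θ r (r , s)) (Θ s (r , s)))
          (cong₂ _+_ (Deletion.2Θ-value r∈Vs s∈Vs rs∈E r~s (λ z → incident-δ z r≢s))
                     (Deletion.2Θ-value s∈Vs r∈Vs rs∈E (trans (adj-sym s r) r~s)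
                                        (λ z → trans (incident-δ z r≢s) (ℤ.+-comm (δ z r) (δ z s)))))
    where
      r≢s = adj⇒≢ r~s

  ∑-2Θ : + 2 * ∑ E (λ g → Θ (proj₁ g) g + Θ (proj₂ g) g) ≡ ∑ Vs (λ r → d r * (φ r - ψ r))
  ∑-2Θ = begin
    + 2 * ∑ E (λ g → Θ (proj₁ g) g + Θ (proj₂ g) g)   ≡⟨ sym (∑-*ˡ E (+ 2) _) ⟩
    ∑ E (λ g → + 2 * (Θ (proj₁ g) g + Θ (proj₂ g) g)) ≡⟨ ∑-cong-∈ E 2Θ-ends ⟩
    ∑ E (λ (r , s) → (φ r - ψ s) + (φ s - ψ r))
      ≡⟨ ∑-edges _ (λ r s → φ r - ψ r) (λ r s _ → regroup (φ r) (φ s) (ψ r) (ψ s)) ⟩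
    ∑ Vs (λ r → ∑ Vs (λ s → a r s * (φ r - ψ r)))     ≡⟨ ∑-cong Vs (λ r → ∑-adj r (φ r - ψ r)) ⟩
    ∑ Vs (λ r → d r * (φ r - ψ r))                    ∎
    where
      open ≡-Reasoning
      regroup : ∀ p q u v → (p - v) + (q - u) ≡ (p - u) + (q - v)
      regroup = solve-∀

  ∑-d[φ-ψ] : ∑ Vs (λ r → d r * (φ r - ψ r))
           ≡ κ * (+ 2 * + numEdges G) + + 6 * + M1 2 G - + 4 * + M1 3 G - + 6 * (+ 2 * + M2 G) - + 2 * + α12 G
  ∑-d[φ-ψ] = begin
    ∑ Vs (λ r → d r * (φ r - ψ r))
      ≡⟨ ∑-cong Vs (λ r → expand κ (d r) (Sd r)) ⟩
    ∑ Vs (λ r → κ * d r + + 6 * sq r - + 4 * cube r - + 6 * dSd r - + 2 * d²Sd r)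
      ≡⟨ ∑---* Vs _ (+ 2) d²Sd ⟩
    ∑ Vs (λ r → κ * d r + + 6 * sq r - + 4 * cube r - + 6 * dSd r) - + 2 * ∑ Vs d²Sd
      ≡⟨ cong (_- + 2 * ∑ Vs d²Sd) (∑---* Vs _ (+ 6) dSd) ⟩
    ∑ Vs (λ r → κ * d r + + 6 * sq r - + 4 * cube r) - + 6 * ∑ Vs dSd - + 2 * ∑ Vs d²Sd
      ≡⟨ cong (λ t → t - + 6 * ∑ Vs dSd - + 2 * ∑ Vs d²Sd) (∑---* Vs _ (+ 4) cube) ⟩
    ∑ Vs (λ r → κ * d r + + 6 * sq r) - + 4 * ∑ Vs cube - + 6 * ∑ Vs dSd - + 2 * ∑ Vs d²Sd
      ≡⟨ cong (λ t → t - + 4 * ∑ Vs cube - + 6 * ∑ Vs dSd - + 2 * ∑ Vs d²Sd)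
              (trans (∑-+-* Vs _ (+ 6) sq) (cong (_+ + 6 * ∑ Vs sq) (∑-*ˡ Vs κ d))) ⟩
    κ * ∑ Vs d + + 6 * ∑ Vs sq - + 4 * ∑ Vs cube - + 6 * ∑ Vs dSd - + 2 * ∑ Vs d²Sd
      ≡⟨ sym (invariants handshake M1²-∑ M1³-∑ M2-∑ α12-∑) ⟩
    κ * (+ 2 * + numEdges G) + + 6 * + M1 2 G - + 4 * + M1 3 G - + 6 * (+ 2 * + M2 G) - + 2 * + α12 G  ∎
    where
      open ≡-Reasoning
      sq cube dSd d²Sd : V → ℤ
      sq r   = d r * d r
      cube r = d r * d r * d r
      dSd r  = d r * Sd r
      d²Sd r = d r * d r * Sd r
      expand : ∀ k p s → p * (k + + 10 * p - + 4 * (p * p) - + 4 * s - + 2 * (p * s) - (+ 4 * p + + 2 * s))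
                         ≡ k * p + + 6 * (p * p) - + 4 * (p * p * p) - + 6 * (p * s) - + 2 * (p * p * s)
      expand = solve-∀
      invariants : ∀ {m₁ m₂ m₃ m₄ m₅ s₁ s₂ s₃ s₄ s₅} →
                   m₁ ≡ s₁ → m₂ ≡ s₂ → m₃ ≡ s₃ → m₄ ≡ s₄ → m₅ ≡ s₅ →
                   κ * m₁ + + 6 * m₂ - + 4 * m₃ - + 6 * m₄ - + 2 * m₅
                   ≡ κ * s₁ + + 6 * s₂ - + 4 * s₃ - + 6 * s₄ - + 2 * s₅
      invariants refl refl refl refl refl = refl

lemma2p22 : {V : Set} (_≟_ : DecidableEquality V) (G : Graph V) → IsSimple G →
    + P2 (⊎-dec _≟_ (×-dec _≟_ _≟_)) Θ2 (S _≟_ G)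
    ≡ (+ 4 * + M1 2 G + + 2 * + M2 G + + 4) * + numEdges G
    - + 8 * (+ numEdges G * + numEdges G)
    - + 2 * + M1 3 G + + 3 * + M1 2 G - + 6 * + M2 G - + α12 G
lemma2p22 _≟_ G simple = ℤ.*-cancelˡ-≡ (+ 2) _ _ (begin
    + 2 * + P2 _≟S_ Θ2 SG                                ≡⟨ cong (+ 2 *_) P2Θ2-∑-edges ⟩
    + 2 * ∑ E (λ g → Θ (proj₁ g) g + Θ (proj₂ g) g)      ≡⟨ ∑-2Θ ⟩
    ∑ Vs (λ r → d r * (φ r - ψ r))                       ≡⟨ ∑-d[φ-ψ] ⟩
    κ * (+ 2 * m) + + 6 * m₁₂ - + 4 * m₁₃ - + 6 * (+ 2 * m₂) - + 2 * α
      ≡⟨ simplify m₁₂ m₁₃ m₂ α m ⟩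
    + 2 * ((+ 4 * m₁₂ + + 2 * m₂ + + 4) * m - + 8 * (m * m) - + 2 * m₁₃ + + 3 * m₁₂ - + 6 * m₂ - α)  ∎)
  where
    open SimpleGraph _≟_ G simple
    open ≡-Reasoning
    m m₁₂ m₁₃ m₂ α : ℤ
    m   = + numEdges G
    m₁₂ = + M1 2 G
    m₁₃ = + M1 3 G
    m₂  = + M2 G
    α   = + α12 G
    simplify : ∀ m₁₂ m₁₃ m₂ α m →
      (+ 4 * m₁₂ + + 2 * m₂ - + 8 * m + + 4) * (+ 2 * m) + + 6 * m₁₂ - + 4 * m₁₃ - + 6 * (+ 2 * m₂) - + 2 * α
      ≡ + 2 * ((+ 4 * m₁₂ + + 2 * m₂ + + 4) * m - + 8 * (m * m) - + 2 * m₁₃ + + 3 * m₁₂ - + 6 * m₂ - α)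
    simplify = solve-∀
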